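{- Let $G$ be an odd cactus, $C$ a cycle in $G$, and $u_1u_2\in E(C)$ an edge such that $w:=\mathrm{opp}(u_1u_2)$ is a cut vertex of $G$. Let $(G_1,G_2)$ be the separation of $G$ with respect to $(u_1u_2,w)$. For any block $B$ of $G$, if the vertex set of the unique $B,C$ path in the block-cut tree of $G$ does not contain $w$, then $E(B)\cap E(G_2)=\emptyset$.
   Context: All graphs are finite, simple, connected and non-empty. A cactus is a graph in which every edge lies in at most one cycle; an odd cactus has no even cycle. A block is a maximal connected subgraph without a cut vertex of its own; in a cactus blocks are cycles or single edges. The block-cut tree of $G$ has as vertices the cut vertices and the blocks of $G$, a cut vertex adjacent to a block iff it lies in it. For an odd cycle $C$ and edge $v_2v_3\in E(C)$, $\mathrm{opp}(v_2v_3)$ is the unique $v_1\in V(C)$ with $d(v_1,v_2)=d(v_1,v_3)$. Separation: for $e\in E(C)$ with $v:=\mathrm{opp}(e)$ a cut vertex, let $K_1,\dots,K_m$ be the components of $G-v$ with $e\in E(K_1)$; the separation of $G$ with respect to $(e,v)$ is $(G_1,G_2)$ where $G_1=G[V(K_1)\cup\{v\}]$ and $G_2=G[\bigcup_{i=2}^mV(K_i)\cup\{v\}]$. -}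

module Defs where

open import Data.Nat using (ℕ; zero; suc; _+_; _*_; _≤_)
open import Data.Nat.DivMod using (_mod_)
open import Data.Fin using (Fin; toℕ; inject₁; fromℕ)
import Data.Fin as F
open import Data.Product using (Σ; ∃; _×_; _,_)
open import Data.Sum using (_⊎_)
open import Data.Unit using (⊤)
open import Data.Empty using (⊥)
open import Relation.Nullary using (¬_)
open import Relation.Binary.PropositionalEquality using (_≡_; _≢_)

record Graph (n : ℕ) : Set₁ where
  field
    adj    : Fin n → Fin n → Set
    sym    : ∀ {u v} → adj u v → adj v u
    irrefl : ∀ {u} → ¬ adj u u
open Graph public

record Sub (n : ℕ) : Set₁ where
  field
    V : Fin n → Set
    E : Fin n → Fin n → Set
open Sub public

module _ {n : ℕ} where

  full : Graph n → Sub n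
  full G = record { V = λ _ → ⊤ ; E = adj G }

  IsSub : Graph n → Sub n → Set
  IsSub G H = (∀ u v → E H u v → adj G u v × V H u × V H v)
            × (∀ u v → E H u v → E H v u)

  data Walk (H : Sub n) : Fin n → Fin n → ℕ → Set where
    []  : ∀ {u} → V H u → Walk H u u 0
    _∷_ : ∀ {u v x l} → E H u v → Walk H v x l → Walk H u x (suc l)

  Reach : Sub n → Fin n → Fin n → Set
  Reach H u v = ∃ λ l → Walk H u v l

  Connected : Sub n → Set
  Connected H = (∃ λ v → V H v) × (∀ u v → V H u → V H v → Reach H u v)

  Disconnected : Sub n → Set
  Disconnected H = ∃ λ u → ∃ λ v → V H u × V H v × ¬ Reach H u v

  del : Sub n → Fin n → Sub n
  del H x = record { V = λ u → V H u × u ≢ x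
                   ; E = λ u v → E H u v × u ≢ x × v ≢ x }

  CutVertexOf : Sub n → Fin n → Set
  CutVertexOf H x = V H x × Disconnected (del H x)

  CutVertex : Graph n → Fin n → Set
  CutVertex G = CutVertexOf (full G)

  _⊆_ : Sub n → Sub n → Set
  H ⊆ K = (∀ u → V H u → V K u) × (∀ u v → E H u v → E K u v)

  _≅_ : Sub n → Sub n → Set
  H ≅ K = H ⊆ K × K ⊆ H

  IsBlock : Graph n → Sub n → Set₁
  IsBlock G B = IsSub G B × Connected B × (∀ x → ¬ CutVertexOf B x)
              × (∀ (H : Sub n) → IsSub G H → Connected H
                   → (∀ x → ¬ CutVertexOf H x) → B ⊆ H → H ⊆ B)

  record Cycle (G : Graph n) : Set where
    field
      m     : ℕ
      len≥3 : 3 ≤ suc m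
      vs    : Fin (suc m) → Fin n
      inj   : ∀ i j → vs i ≡ vs j → i ≡ j
      adjc  : ∀ i → adj G (vs i) (vs ((suc (toℕ i)) mod (suc m)))
  open Cycle public

  cyclen : {G : Graph n} → Cycle G → ℕ
  cyclen C = suc (m C)

  cycleSub : {G : Graph n} → Cycle G → Sub n
  cycleSub C = record
    { V = λ u → ∃ λ i → vs C i ≡ u
    ; E = λ u v → ∃ λ i →
            (vs C i ≡ u × vs C ((suc (toℕ i)) mod (cyclen C)) ≡ v)
          ⊎ (vs C i ≡ v × vs C ((suc (toℕ i)) mod (cyclen C)) ≡ u) }

  Odd : ℕ → Set
  Odd k = ∃ λ j → k ≡ suc (2 * j)

  -- odd cactus: no even cycle, every edge in at most one cycle
  OddCactus : Graph n → Set
  OddCactus G = (∀ (C : Cycle G) → Odd (cyclen C))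
              × (∀ (C D : Cycle G) u v → E (cycleSub C) u v → E (cycleSub D) u v
                   → cycleSub C ≅ cycleSub D)

  Dist : Sub n → Fin n → Fin n → ℕ → Set
  Dist H u v d = Walk H u v d × (∀ l → Walk H u v l → d ≤ l)

  Opp : {G : Graph n} → Cycle G → Fin n → Fin n → Fin n → Set
  Opp C u₁ u₂ w = V (cycleSub C) w
                × ∃ λ d → Dist (cycleSub C) w u₁ d × Dist (cycleSub C) w u₂ d

  -- a path B = B_0, c_1, B_1, ..., c_k, B_k = D in the block-cut tree of G
  record BCPath (G : Graph n) (B D : Sub n) : Set₁ where
    field
      k      : ℕ
      blk    : Fin (suc k) → Sub n
      cut    : Fin k → Fin n
      blkIs  : ∀ i → IsBlock G (blk i)
      cutIs  : ∀ i → CutVertex G (cut i)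
      inL    : ∀ i → V (blk (inject₁ i)) (cut i)
      inR    : ∀ i → V (blk (F.suc i)) (cut i)
      start  : blk F.zero ≅ B
      end    : blk (fromℕ k) ≅ D
      cutInj : ∀ i j → cut i ≡ cut j → i ≡ j
      blkInj : ∀ i j → blk i ≅ blk j → i ≡ j
  open BCPath public

  -- G_2 of the separation of G w.r.t. (u1u2, w):
  -- induced on w together with the components of G - w not containing u1
  sepG₂ : Graph n → Fin n → Fin n → Sub n
  sepG₂ G u₁ w = record { V = V₂ ; E = λ u v → adj G u v × V₂ u × V₂ v }
    where
      V₂ : Fin n → Set
      V₂ x = x ≡ w ⊎ (x ≢ w × ¬ Reach (del (full G) w) x u₁)

module Submission where

-- Call a subgraph K "tethered to u₁ in G - w" when every
-- vertex x ≠ w of K is connected to u₁ in G - w (classically; we work under a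
-- double negation since membership in a block is not decidable).
--   * A block containing one tethered vertex y ≠ w is tethered: if w ∉ K,
--     every walk inside K avoids w; if w ∈ K, then K - w is connected because
--     a block has no cut vertex of its own.
--   * Consecutive blocks of a block-cut path share a cut vertex, which is ≠ w
--     by hypothesis, so tethering propagates from the last block (the cycle's
--     block, which contains u₁ ≠ w) back to the first block B.
--   * An edge of G₂ has an endpoint x ≠ w that is NOT connected to u₁ in
--     G - w; if the edge also lay in B, x would be tethered, a contradiction.
-- Only u₁ ∈ C and u₁ ≠ w = opp(u₁u₂) are needed from the cycle.

open import Defs
open import Data.Nat using (ℕ; zero; suc; _+_)
open import Data.Fin using (Fin; fromℕ; inject₁)
import Data.Fin as F
open import Data.Product using (_×_; _,_; proj₁; proj₂)
open import Data.Sum using (inj₁; inj₂)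
open import Data.Unit using (tt)
open import Data.Empty using (⊥)
open import Relation.Nullary using (¬_; yes; no; ¬¬-excluded-middle)
open import Relation.Binary.PropositionalEquality using (_≡_; _≢_; refl; subst)
  renaming (sym to ≡-sym)

_++ʷ_ : ∀ {n} {H : Sub n} {x y z l l′} → Walk H x y l → Walk H y z l′ → Walk H x z (l + l′)
[] _    ++ʷ q = q
(e ∷ p) ++ʷ q = e ∷ (p ++ʷ q)

walk₀-ends : ∀ {n} {H : Sub n} {x y} → Walk H x y 0 → x ≡ y
walk₀-ends ([] _) = refl

cycleEdge⇒adj : ∀ {n} {G : Graph n} (C : Cycle G) {u v} → E (cycleSub C) u v → adj G u v
cycleEdge⇒adj C (i , inj₁ (refl , refl)) = adjc C i
cycleEdge⇒adj {G = G} C (i , inj₂ (refl , refl)) = Graph.sym G (adjc C i)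

cycleEdge⇒vertex : ∀ {n} {G : Graph n} (C : Cycle G) {u v} → E (cycleSub C) u v → V (cycleSub C) u
cycleEdge⇒vertex C (i , inj₁ (p , _)) = i , p
cycleEdge⇒vertex C (i , inj₂ (_ , q)) = _ , q

-- The vertex opposite to an edge u₁u₂ is not u₁: otherwise its distance to
-- u₁ would be 0, forcing u₂ = u₁, a loop.
opp≢endpoint : ∀ {n} {G : Graph n} (C : Cycle G) {u₁ u₂ w}
             → adj G u₁ u₂ → Opp C u₁ u₂ w → u₁ ≢ w
opp≢endpoint {G = G} C a (_ , zero , _ , (q , _)) refl =
  irrefl G (subst (adj G _) (≡-sym (walk₀-ends q)) a)
opp≢endpoint C a (Vw , suc d , (_ , minimal) , _) refl with minimal 0 ([] Vw)
... | ()

module Tethering {n : ℕ} (G : Graph n) (w : Fin n) where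

  G-w : Sub n
  G-w = del (full G) w

  walk-avoiding : ∀ {H : Sub n} → (∀ a b → E H a b → adj G a b × a ≢ w × b ≢ w)
                → ∀ {x y l} → x ≢ w → Walk H x y l → Walk G-w x y l
  walk-avoiding edge x≢w ([] _) = [] (tt , x≢w)
  walk-avoiding edge x≢w (_∷_ {u} {v} e p) with edge u v e
  ... | a , _ , v≢w = (a , x≢w , v≢w) ∷ walk-avoiding edge v≢w p

  Tethered : Sub n → Fin n → Set
  Tethered K u₁ = ∀ x → V K x → x ≢ w → ¬ ¬ Reach G-w x u₁

  -- If w ∈ K, a vertex
  -- x ≠ w not tethered would be separated from y in K - w, making w a cut
  -- vertex of K; if w ∉ K, a walk from x to y inside K already avoids w.
  block-tethered : ∀ K u₁ → IsBlock G K → ∀ y → V K y → y ≢ w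
                 → ¬ ¬ Reach G-w y u₁ → Tethered K u₁
  block-tethered K u₁ ((sub , _) , (_ , connected) , noCut , _) y Ky y≢w y↝u₁ x Kx x≢w ¬x↝u₁ =
    ¬¬-excluded-middle λ
      { (yes Kw) → noCut w (Kw , x , y , (Kx , x≢w) , (Ky , y≢w) ,
                              via (λ a b e → proj₁ (sub a b (proj₁ e)) , proj₂ e))
      ; (no ¬Kw) → via (edge-avoiding ¬Kw) (connected x y Kx Ky) }
    where
      edge-avoiding : ¬ V K w → ∀ a b → E K a b → adj G a b × a ≢ w × b ≢ w
      edge-avoiding ¬Kw a b e with sub a b e
      ... | a~b , Ka , Kb = a~b , (λ { refl → ¬Kw Ka }) , (λ { refl → ¬Kw Kb })
      via : ∀ {H : Sub n} → (∀ a b → E H a b → adj G a b × a ≢ w × b ≢ w) → ¬ Reach H x y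
      via edge (_ , p) = y↝u₁ λ { (_ , q) → ¬x↝u₁ (_ , walk-avoiding edge x≢w p ++ʷ q) }

  chain-tethered : ∀ u₁ k (blk : Fin (suc k) → Sub n) (link : Fin k → Fin n)
                 → (∀ i → IsBlock G (blk i))
                 → (∀ i → V (blk (inject₁ i)) (link i))
                 → (∀ i → V (blk (F.suc i)) (link i))
                 → (∀ i → link i ≢ w)
                 → Tethered (blk (fromℕ k)) u₁ → Tethered (blk F.zero) u₁
  chain-tethered u₁ zero    blk link isBlk inL inR link≢w last = last
  chain-tethered u₁ (suc k) blk link isBlk inL inR link≢w last =
    block-tethered (blk F.zero) u₁ (isBlk F.zero) (link F.zero) (inL F.zero) (link≢w F.zero)
      (second (link F.zero) (inR F.zero) (link≢w F.zero))
    where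
      second : Tethered (blk (F.suc F.zero)) u₁
      second = chain-tethered u₁ k (λ i → blk (F.suc i)) (λ i → link (F.suc i))
                 (λ i → isBlk (F.suc i)) (λ i → inL (F.suc i)) (λ i → inR (F.suc i))
                 (λ i → link≢w (F.suc i)) last

  -- A subgraph of G all of whose vertices are tethered to u₁ shares no edge
  -- with G₂: an edge of G₂ is not a loop at w, so it has an endpoint ≠ w
  -- lying outside the component of u₁ in G - w.
  tethered-misses-G₂ : ∀ K u₁ → IsSub G K → Tethered K u₁
                     → ∀ u v → E K u v → E (sepG₂ G u₁ w) u v → ⊥
  tethered-misses-G₂ K u₁ (sub , _) tethered u v e (u~v , G₂u , G₂v) with sub u v e
  ... | _ , Ku , Kv = escape G₂u G₂v
    where
      escape : _ → _ → ⊥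
      escape (inj₂ (u≢w , ¬u↝u₁)) _                     = tethered u Ku u≢w ¬u↝u₁
      escape (inj₁ _)             (inj₂ (v≢w , ¬v↝u₁)) = tethered v Kv v≢w ¬v↝u₁
      escape (inj₁ refl)          (inj₁ refl)          = irrefl G u~v

open Tethering

lemma6 : ∀ {n : ℕ} (G : Graph n) → Connected (full G) → OddCactus G
    → (C : Cycle G) (u₁ u₂ w : Fin n) → E (cycleSub C) u₁ u₂
    → Opp C u₁ u₂ w → CutVertex G w
    → (B : Sub n) → IsBlock G B
    → (P : BCPath G B (cycleSub C)) → (∀ i → cut P i ≢ w)
    → ∀ u v → E B u v → E (sepG₂ G u₁ w) u v → ⊥
lemma6 G _ _ C u₁ u₂ w u₁u₂ opp _ B isBlockB P cut≢w =
  tethered-misses-G₂ G w B u₁ (proj₁ isBlockB) B-tethered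
  where
    u₁≢w : u₁ ≢ w
    u₁≢w = opp≢endpoint C (cycleEdge⇒adj C u₁u₂) opp
    last-tethered : Tethered G w (blk P (fromℕ (k P))) u₁
    last-tethered = block-tethered G w (blk P (fromℕ (k P))) u₁ (blkIs P _) u₁
                      (proj₁ (proj₂ (end P)) u₁ (cycleEdge⇒vertex C u₁u₂)) u₁≢w
                      (λ ¬u₁↝u₁ → ¬u₁↝u₁ (0 , [] (tt , u₁≢w)))
    first-tethered : Tethered G w (blk P F.zero) u₁
    first-tethered = chain-tethered G w u₁ (k P) (blk P) (cut P) (blkIs P) (inL P) (inR P)
                       cut≢w last-tethered
    B-tethered : Tethered G w B u₁
    B-tethered x Bx = first-tethered x (proj₁ (proj₂ (start P)) x Bx)
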